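{- Let $n\ge 1$ and let $G$ be a self-complementary graph on $4n$ vertices, and suppose there is an isomorphism $\rho: G\to cG$ which, as a permutation of $V(G)$, factors as a product of two disjoint cycles of lengths $4k$ and $4l=4(n-k)$ (with $k,l\ge 1$). Let $L$ be the set of edges of $G$ joining a vertex of degree at least $2n$ to a vertex of degree at most $2n-1$. Then $G$ contains a $K_{2n}$ minor obtained by contracting $2n$ pairwise nonadjacent edges belonging to $L$.
   Context: Graphs are finite, simple and undirected. $cG$ denotes the complement of $G$ (same vertex set, two distinct vertices adjacent in $cG$ iff not adjacent in $G$); $G$ is self-complementary if $G\cong cG$. A minor is obtained by edge deletions, vertex deletions and edge contractions. -}

module Defs where

open import Data.Nat using (ℕ; zero; suc; _+_; _*_; _≤_; _<_; _∸_)
open import Data.Bool using (Bool; true; false; not; if_then_else_)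
open import Data.Fin using (Fin; _≟_)
open import Data.Fin.Permutation using (Permutation′; _⟨$⟩ʳ_)
open import Data.List using (List; map; allFin)
open import Data.Nat.ListAction using (sum)
open import Data.Product using (Σ; ∃; _×_; _,_)
open import Data.Sum using (_⊎_)
import Data.Empty
open import Relation.Nullary using (¬_; yes; no)
open import Relation.Binary.PropositionalEquality using (_≡_; _≢_; refl)

record Graph (m : ℕ) : Set where
  field
    adj    : Fin m → Fin m → Bool
    adj-sym : ∀ u v → adj u v ≡ adj v u
    irrefl : ∀ u → adj u u ≡ false
open Graph public

cAdj : ∀ {m} → Graph m → Fin m → Fin m → Bool
cAdj G u v with u ≟ v
... | yes _ = false
... | no _  = not (adj G u v)

c : ∀ {m} → Graph m → Graph m
c {m} G = record { adj = cAdj G ; adj-sym = s ; irrefl = i }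
  where
  s : ∀ u v → cAdj G u v ≡ cAdj G v u
  s u v with u ≟ v | v ≟ u
  ... | yes _ | yes _ = refl
  ... | yes refl | no v≢u = ⊥-elim' (v≢u refl)
    where ⊥-elim' : ∀ {A : Set} → Data.Empty.⊥ → A
          ⊥-elim' ()
  ... | no u≢v | yes refl = ⊥-elim' (u≢v refl)
    where ⊥-elim' : ∀ {A : Set} → Data.Empty.⊥ → A
          ⊥-elim' ()
  ... | no _ | no _ rewrite Graph.adj-sym G u v = refl
  i : ∀ u → cAdj G u u ≡ false
  i u with u ≟ u
  ... | yes _ = refl
  ... | no u≢u = ⊥-elim' (u≢u refl)
    where ⊥-elim' : ∀ {A : Set} → Data.Empty.⊥ → A
          ⊥-elim' ()

IsIso : ∀ {m} → Graph m → Graph m → Permutation′ m → Set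
IsIso G H ρ = ∀ u v → adj H (ρ ⟨$⟩ʳ u) (ρ ⟨$⟩ʳ v) ≡ adj G u v

deg : ∀ {m} → Graph m → Fin m → ℕ
deg {m} G u = sum (map (λ v → if adj G u v then 1 else 0) (allFin m))

iter : ∀ {m} → Permutation′ m → ℕ → Fin m → Fin m
iter ρ zero    x = x
iter ρ (suc i) x = ρ ⟨$⟩ʳ (iter ρ i x)

IsCycleOf : ∀ {m} → Permutation′ m → Fin m → ℕ → Set
IsCycleOf ρ a len =
  (iter ρ len a ≡ a) × (∀ i j → i < len → j < len → iter ρ i a ≡ iter ρ j a → i ≡ j)

TwoCycles : ∀ {m} → Permutation′ m → ℕ → ℕ → Set
TwoCycles {m} ρ p q = Σ (Fin m) λ a → Σ (Fin m) λ b →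
  IsCycleOf ρ a p × IsCycleOf ρ b q
  × (∀ i j → i < p → j < q → iter ρ i a ≢ iter ρ j b)
  × (∀ v → (∃ λ i → i < p × v ≡ iter ρ i a) ⊎ (∃ λ j → j < q × v ≡ iter ρ j b))

InL : ∀ {m} → Graph m → ℕ → Fin m → Fin m → Set
InL G n x y = (adj G x y ≡ true) × (2 * n ≤ deg G x) × (deg G y < 2 * n)

-- contracting the pairwise disjoint edges e i = (x i , y i) (i : Fin t) of a graph whose
-- vertices are exactly their endpoints yields the graph on Fin t where i ~ j (i ≠ j) iff
-- some edge of G joins {x i , y i} to {x j , y j}
ContractAdj : ∀ {m t} → Graph m → (Fin t → Fin m) → (Fin t → Fin m) → Fin t → Fin t → Set
ContractAdj G x y i j =
  (adj G (x i) (x j) ≡ true) ⊎ (adj G (x i) (y j) ≡ true)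
  ⊎ (adj G (y i) (x j) ≡ true) ⊎ (adj G (y i) (y j) ≡ true)

-- Since ρ maps G onto its complement, ρ² is an automorphism of G, and for u ≠ v exactly
-- one of uv and ρ(u)ρ(v) is an edge. On each ρ-cycle some vertex u is adjacent to ρ(u)
-- (if a ≁ ρa then ρa ∼ ρ²a), hence ρ²ᵗu ∼ ρ²ᵗ⁺¹u for all t, and as the cycles have even
-- length these edges pair up all vertices of the cycle: 2n disjoint edges {xᵢ , ρxᵢ}.
-- Each lies in L because deg ρu + deg u = 4n − 1, and the contraction is complete since
-- xᵢ ≁ xⱼ forces ρxᵢ ∼ ρxⱼ.

module Submission where

open import Defs
open import Data.Nat using (ℕ; zero; suc; _+_; _*_; _≤_; _<_; _%_; _/_; _≤?_; NonZero; >-nonZero; z≤n; s≤s)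
open import Data.Nat.Properties hiding (_≟_)
open import Data.Nat.DivMod using (m≡m%n+[m/n]*n; m%n<n)
open import Data.Nat.ListAction using (sum)
open import Data.Bool using (Bool; true; false; not; if_then_else_)
open import Data.Bool.Properties using (not-involutive)
open import Data.Fin using (Fin; zero; suc; toℕ; splitAt; join; punchIn; _≟_)
open import Data.Fin.Properties using (toℕ<n; toℕ-injective; join-splitAt; punchInᵢ≢i)
open import Data.Fin.Permutation using (Permutation′; _⟨$⟩ʳ_; _⟨$⟩ˡ_; inverseˡ)
open import Data.List using (tabulate)
open import Data.List.Properties using (map-tabulate)
open import Data.Product using (Σ; ∃; _×_; _,_; proj₁; proj₂)
open import Data.Sum using (_⊎_; inj₁; inj₂; [_,_])
import Data.Sum as Sum
open import Data.Empty using (⊥-elim)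
open import Function using (_∘_; id)
open import Relation.Nullary using (yes; no)
open import Relation.Binary.PropositionalEquality hiding ([_])
open import Algebra.Properties.CommutativeMonoid.Sum +-0-commutativeMonoid
  using (∑-permute; ∑-distrib-+; sum-remove; sum-cong-≗) renaming (sum to ∑)

indicator : Bool → ℕ
indicator b = if b then 1 else 0

sum-tabulate : ∀ {m} (f : Fin m → ℕ) → sum (tabulate f) ≡ ∑ f
sum-tabulate {zero}  f = refl
sum-tabulate {suc m} f = cong (f zero +_) (sum-tabulate (f ∘ suc))

∑-ones : ∀ m → ∑ {m} (λ _ → 1) ≡ m
∑-ones zero    = refl
∑-ones (suc m) = cong suc (∑-ones m)

deg≡∑ : ∀ {m} (G : Graph m) u → deg G u ≡ ∑ (indicator ∘ adj G u)
deg≡∑ G u =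
  trans (cong sum (map-tabulate id (indicator ∘ adj G u))) (sum-tabulate (indicator ∘ adj G u))

deg-iso : ∀ {m} {G H : Graph m} {ρ} → IsIso G H ρ → ∀ u → deg H (ρ ⟨$⟩ʳ u) ≡ deg G u
deg-iso {G = G} {H} {ρ} iso u = begin
  deg H (ρ ⟨$⟩ʳ u)                                   ≡⟨ deg≡∑ H _ ⟩
  ∑ (indicator ∘ adj H (ρ ⟨$⟩ʳ u))                   ≡⟨ ∑-permute _ ρ ⟩
  ∑ (λ w → indicator (adj H (ρ ⟨$⟩ʳ u) (ρ ⟨$⟩ʳ w)))  ≡⟨ sum-cong-≗ (cong indicator ∘ iso u) ⟩
  ∑ (indicator ∘ adj G u)                            ≡⟨ deg≡∑ G u ⟨
  deg G u                                            ∎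
  where open ≡-Reasoning

indicator+indicator-not : ∀ b → indicator b + indicator (not b) ≡ 1
indicator+indicator-not true  = refl
indicator+indicator-not false = refl

indicator-adj+cAdj : ∀ {m} (G : Graph m) {u w} → u ≢ w →
                     indicator (adj G u w) + indicator (cAdj G u w) ≡ 1
indicator-adj+cAdj G {u} {w} u≢w with u ≟ w
... | yes u≡w = ⊥-elim (u≢w u≡w)
... | no _    = indicator+indicator-not (adj G u w)

deg+deg-complement : ∀ {m} (G : Graph m) u → suc (deg G u + deg (c G) u) ≡ m
deg+deg-complement {suc m} G u = cong suc (begin
  deg G u + deg (c G) u          ≡⟨ cong₂ _+_ (deg≡∑ G u) (deg≡∑ (c G) u) ⟩
  ∑ f + ∑ g                      ≡⟨ ∑-distrib-+ f g ⟨
  ∑ (λ w → f w + g w)            ≡⟨ sum-remove {i = u} (λ w → f w + g w) ⟩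
  f u + g u + ∑ (λ j → f (punchIn u j) + g (punchIn u j))
    ≡⟨ cong₂ _+_ (cong₂ _+_ (cong indicator (irrefl G u)) (cong indicator (irrefl (c G) u)))
                 (sum-cong-≗ (λ j → indicator-adj+cAdj G (punchInᵢ≢i u j ∘ sym))) ⟩
  ∑ {m} (λ _ → 1)                ≡⟨ ∑-ones m ⟩
  m                              ∎)
  where
  open ≡-Reasoning
  f g : Fin (suc m) → ℕ
  f = indicator ∘ adj G u
  g = indicator ∘ adj (c G) u

splitAt-injective : ∀ p {q} {i j : Fin (p + q)} → splitAt p i ≡ splitAt p j → i ≡ j
splitAt-injective p {q} {i} {j} e =
  trans (sym (join-splitAt p q i)) (trans (cong (join p q) e) (join-splitAt p q j))

module _ {m} (ρ : Permutation′ m) where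

  ρ-injective : ∀ {u v} → ρ ⟨$⟩ʳ u ≡ ρ ⟨$⟩ʳ v → u ≡ v
  ρ-injective e = trans (sym (inverseˡ ρ)) (trans (cong (ρ ⟨$⟩ˡ_) e) (inverseˡ ρ))

  iter-+ : ∀ i j x → iter ρ i (iter ρ j x) ≡ iter ρ (i + j) x
  iter-+ zero    j x = refl
  iter-+ (suc i) j x = cong (ρ ⟨$⟩ʳ_) (iter-+ i j x)

  iter-comm : ∀ i j x → iter ρ i (iter ρ j x) ≡ iter ρ j (iter ρ i x)
  iter-comm i j x =
    trans (iter-+ i j x) (trans (cong (λ s → iter ρ s x) (+-comm i j)) (sym (iter-+ j i x)))

  iter-injective : ∀ s {x y} → iter ρ s x ≡ iter ρ s y → x ≡ y
  iter-injective zero    e = e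
  iter-injective (suc s) e = iter-injective s (ρ-injective e)

  iter-periodic : ∀ {a p} → iter ρ p a ≡ a → ∀ q → iter ρ (q * p) a ≡ a
  iter-periodic         period zero    = refl
  iter-periodic {a} {p} period (suc q) =
    trans (sym (iter-+ p (q * p) a)) (trans (cong (iter ρ p) (iter-periodic period q)) period)

  iter-mod : ∀ {a p} .{{_ : NonZero p}} → iter ρ p a ≡ a → ∀ i → iter ρ i a ≡ iter ρ (i % p) a
  iter-mod {a} {p} period i = begin
    iter ρ i a                                  ≡⟨ cong (λ s → iter ρ s a) (m≡m%n+[m/n]*n i p) ⟩
    iter ρ (i % p + (i / p) * p) a              ≡⟨ iter-+ (i % p) ((i / p) * p) a ⟨
    iter ρ (i % p) (iter ρ ((i / p) * p) a)     ≡⟨ cong (iter ρ (i % p)) (iter-periodic period (i / p)) ⟩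
    iter ρ (i % p) a                            ∎
    where open ≡-Reasoning

  IsCycleOf-iter : ∀ {a p} → IsCycleOf ρ a p → ∀ s → IsCycleOf ρ (iter ρ s a) p
  IsCycleOf-iter {a} {p} (period , distinct) s =
      trans (iter-comm p s a) (cong (iter ρ s) period)
    , λ i j i<p j<p e → distinct i j i<p j<p
        (iter-injective s (trans (iter-comm s i a) (trans e (iter-comm j s a))))

  cycle-moves : ∀ {a p} → IsCycleOf ρ a p → 1 < p → a ≢ ρ ⟨$⟩ʳ a
  cycle-moves (_ , distinct) 1<p e with distinct 0 1 (<⇒≤ 1<p) 1<p e
  ... | ()

  DisjointOrbits : Fin m → Fin m → Set
  DisjointOrbits u v = ∀ i j → iter ρ i u ≢ iter ρ j v

  OnOrbit : Fin m → Fin m → Set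
  OnOrbit a v = ∃ λ s → iter ρ s a ≡ v

  disjointOrbits-onOrbit : ∀ {a b u v} → DisjointOrbits a b → OnOrbit a u → OnOrbit b v →
                           DisjointOrbits u v
  disjointOrbits-onOrbit {a} {b} apart (s , refl) (s′ , refl) i j e =
    apart (i + s) (j + s′) (trans (sym (iter-+ i s a)) (trans e (iter-+ j s′ b)))

  cycles-disjointOrbits : ∀ {a b p q} .{{_ : NonZero p}} .{{_ : NonZero q}} →
    IsCycleOf ρ a p → IsCycleOf ρ b q →
    (∀ i j → i < p → j < q → iter ρ i a ≢ iter ρ j b) → DisjointOrbits a b
  cycles-disjointOrbits {p = p} {q} (periodA , _) (periodB , _) apart i j e =
    apart (i % p) (j % q) (m%n<n i p) (m%n<n j q)
      (trans (sym (iter-mod periodA i)) (trans e (iter-mod periodB j)))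

module Antimorphism {m} (G : Graph m) (ρ : Permutation′ m) (iso : IsIso G (c G) ρ) where

  adj-ρ : ∀ {u v} → u ≢ v → adj G (ρ ⟨$⟩ʳ u) (ρ ⟨$⟩ʳ v) ≡ not (adj G u v)
  adj-ρ {u} {v} u≢v with ρ ⟨$⟩ʳ u ≟ ρ ⟨$⟩ʳ v | iso u v
  ... | yes ρu≡ρv | _          = ⊥-elim (u≢v (ρ-injective ρ ρu≡ρv))
  ... | no _      | not-adj≡adj = trans (sym (not-involutive _)) (cong not not-adj≡adj)

  adj-ρ² : ∀ u v → adj G (ρ ⟨$⟩ʳ (ρ ⟨$⟩ʳ u)) (ρ ⟨$⟩ʳ (ρ ⟨$⟩ʳ v)) ≡ adj G u v
  adj-ρ² u v with u ≟ v
  ... | yes refl = trans (irrefl G _) (sym (irrefl G u))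
  ... | no u≢v   = trans (adj-ρ (u≢v ∘ ρ-injective ρ))
                         (trans (cong not (adj-ρ u≢v)) (not-involutive _))

  adj-iter-even : ∀ t u v → adj G (iter ρ (2 * t) u) (iter ρ (2 * t) v) ≡ adj G u v
  adj-iter-even zero    u v = refl
  adj-iter-even (suc t) u v =
    trans (cong₂ (adj G) (two-steps u) (two-steps v)) (trans (adj-ρ² _ _) (adj-iter-even t u v))
    where
    two-steps : ∀ w → iter ρ (2 * suc t) w ≡ ρ ⟨$⟩ʳ (ρ ⟨$⟩ʳ iter ρ (2 * t) w)
    two-steps w = cong (λ s → iter ρ s w) (*-suc 2 t)

  edge-on-orbit : ∀ {a} → a ≢ ρ ⟨$⟩ʳ a → ∃ λ s → adj G (iter ρ s a) (ρ ⟨$⟩ʳ iter ρ s a) ≡ true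
  edge-on-orbit {a} a≢ρa with adj G a (ρ ⟨$⟩ʳ a) in e
  ... | true  = 0 , e
  ... | false = 1 , trans (adj-ρ a≢ρa) (cong not e)

  deg-ρ : ∀ u → suc (deg G (ρ ⟨$⟩ʳ u) + deg G u) ≡ m
  deg-ρ u =
    trans (cong (λ d → suc (deg G (ρ ⟨$⟩ʳ u) + d)) (sym (deg-iso {G = G} {c G} {ρ} iso u)))
          (deg+deg-complement G (ρ ⟨$⟩ʳ u))

  adj-or-adj-ρ : ∀ {u v} → u ≢ v → adj G u v ≡ true ⊎ adj G (ρ ⟨$⟩ʳ u) (ρ ⟨$⟩ʳ v) ≡ true
  adj-or-adj-ρ {u} {v} u≢v with adj G u v in e
  ... | true  = inj₁ refl
  ... | false = inj₂ (trans (adj-ρ u≢v) (cong not e))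

  record Matching (p : ℕ) : Set where
    field
      x           : Fin p → Fin m
      edge        : ∀ t → adj G (x t) (ρ ⟨$⟩ʳ x t) ≡ true
      x-injective : ∀ {t t′} → x t ≡ x t′ → t ≡ t′
      x≢ρx        : ∀ t t′ → x t ≢ ρ ⟨$⟩ʳ x t′

  cycleMatching : ∀ {u p} → IsCycleOf ρ u (2 * p) → adj G u (ρ ⟨$⟩ʳ u) ≡ true → Matching p
  cycleMatching {u} {p} (_ , distinct) u~ρu = record
    { x           = x
    ; edge        = edge
    ; x-injective = λ {t} {t′} e →
        toℕ-injective (*-cancelˡ-≡ _ _ 2 (distinct _ _ (even< t) (even< t′) e))
    ; x≢ρx        = λ t t′ e → even≢odd (toℕ t) (toℕ t′) (distinct _ _ (even< t) (odd< t′) e)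
    }
    where
    x : Fin p → Fin m
    x t = iter ρ (2 * toℕ t) u

    even< : ∀ t → 2 * toℕ t < 2 * p
    even< t = *-monoʳ-< 2 (toℕ<n t)

    odd< : ∀ t → suc (2 * toℕ t) < 2 * p
    odd< t = subst (_≤ 2 * p) (*-suc 2 (toℕ t)) (*-monoʳ-≤ 2 (toℕ<n t))

    edge : ∀ t → adj G (x t) (ρ ⟨$⟩ʳ x t) ≡ true
    edge t = begin
      adj G (x t) (ρ ⟨$⟩ʳ x t)                     ≡⟨ cong (adj G (x t)) (iter-comm ρ (2 * toℕ t) 1 u) ⟨
      adj G (x t) (iter ρ (2 * toℕ t) (ρ ⟨$⟩ʳ u))  ≡⟨ adj-iter-even (toℕ t) u (ρ ⟨$⟩ʳ u) ⟩
      adj G u (ρ ⟨$⟩ʳ u)                           ≡⟨ u~ρu ⟩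
      true                                         ∎
      where open ≡-Reasoning

  OrbitMatching : Fin m → ℕ → Set
  OrbitMatching a p = Σ (Matching p) λ M → ∀ t → OnOrbit ρ a (Matching.x M t)

  orbitMatching : ∀ {a p} → IsCycleOf ρ a (2 * p) → 1 ≤ p → OrbitMatching a p
  orbitMatching {a} cycle p≥1 with edge-on-orbit (cycle-moves ρ cycle (*-monoʳ-≤ 2 p≥1))
  ... | s , e = cycleMatching (IsCycleOf-iter ρ cycle s) e
              , λ t → 2 * toℕ t + s , sym (iter-+ ρ (2 * toℕ t) s a)

  matching-++ : ∀ {p q} (M : Matching p) (N : Matching q) →
    (∀ t t′ → DisjointOrbits ρ (Matching.x M t) (Matching.x N t′)) → Matching (p + q)
  matching-++ {p} {q} M N apart = record
    { x = x ; edge = edge ; x-injective = x-injective ; x≢ρx = x≢ρx }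
    where
    module M = Matching M
    module N = Matching N

    x : Fin (p + q) → Fin m
    x i = [ M.x , N.x ] (splitAt p i)

    edge : ∀ i → adj G (x i) (ρ ⟨$⟩ʳ x i) ≡ true
    edge i with splitAt p i
    ... | inj₁ t = M.edge t
    ... | inj₂ t = N.edge t

    x-injective : ∀ {i j} → x i ≡ x j → i ≡ j
    x-injective {i} {j} e with splitAt p i in eqi | splitAt p j in eqj
    ... | inj₁ t | inj₁ t′ =
      splitAt-injective p (trans eqi (trans (cong inj₁ (M.x-injective e)) (sym eqj)))
    ... | inj₁ t | inj₂ t′ = ⊥-elim (apart t t′ 0 0 e)
    ... | inj₂ t | inj₁ t′ = ⊥-elim (apart t′ t 0 0 (sym e))
    ... | inj₂ t | inj₂ t′ =
      splitAt-injective p (trans eqi (trans (cong inj₂ (N.x-injective e)) (sym eqj)))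

    x≢ρx : ∀ i j → x i ≢ ρ ⟨$⟩ʳ x j
    x≢ρx i j with splitAt p i | splitAt p j
    ... | inj₁ t | inj₁ t′ = M.x≢ρx t t′
    ... | inj₁ t | inj₂ t′ = apart t t′ 0 1
    ... | inj₂ t | inj₁ t′ = apart t′ t 1 0 ∘ sym
    ... | inj₂ t | inj₂ t′ = N.x≢ρx t t′

straddle : ∀ {x y h} → suc (x + y) ≡ h + h → (h ≤ x × y < h) ⊎ (x < h × h ≤ y)
straddle {x} {y} {h} e with h ≤? x
... | yes h≤x = inj₁ (h≤x , +-cancelˡ-≤ h (suc y) h (begin
  h + suc y  ≤⟨ +-monoˡ-≤ (suc y) h≤x ⟩
  x + suc y  ≡⟨ +-suc x y ⟩
  suc x + y  ≡⟨ e ⟩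
  h + h      ∎))
  where open ≤-Reasoning
... | no h≰x = inj₂ (x<h , +-cancelˡ-≤ h h y (begin
  h + h      ≡⟨ e ⟨
  suc x + y  ≤⟨ +-monoˡ-≤ y x<h ⟩
  h + y      ∎))
  where
  open ≤-Reasoning
  x<h : x < h
  x<h = ≰⇒> h≰x

edge-ρ-in-L : ∀ {n} (G : Graph (4 * n)) ρ → IsIso G (c G) ρ →
              ∀ {u} → adj G u (ρ ⟨$⟩ʳ u) ≡ true → InL G n u (ρ ⟨$⟩ʳ u) ⊎ InL G n (ρ ⟨$⟩ʳ u) u
edge-ρ-in-L {n} G ρ iso {u} u~ρu
  with straddle (trans (Antimorphism.deg-ρ G ρ iso u) (*-distribʳ-+ n 2 2))
... | inj₁ (2n≤deg-ρu , deg-u<2n) = inj₂ (trans (adj-sym G _ _) u~ρu , 2n≤deg-ρu , deg-u<2n)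
... | inj₂ (deg-ρu<2n , 2n≤deg-u) = inj₁ (u~ρu , 2n≤deg-u , deg-ρu<2n)

lemma6 : (n k l : ℕ) → 1 ≤ n → 1 ≤ k → 1 ≤ l → k + l ≡ n →
    (G : Graph (4 * n)) → (ρ : Permutation′ (4 * n)) → IsIso G (c G) ρ →
    TwoCycles ρ (4 * k) (4 * l) →
    Σ (Fin (2 * n) → Fin (4 * n)) λ x → Σ (Fin (2 * n) → Fin (4 * n)) λ y →
      (∀ i → InL G n (x i) (y i) ⊎ InL G n (y i) (x i))
      × (∀ i j → i ≢ j → (x i ≢ x j) × (x i ≢ y j) × (y i ≢ y j))
      × (∀ i j → i ≢ j → ContractAdj G x y i j)
lemma6 n k l _ k≥1 l≥1 k+l≡n G ρ iso (a , b , cycleA , cycleB , apart , _) =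
    x , (λ i → ρ ⟨$⟩ʳ x i)
  , (λ i → edge-ρ-in-L {n} G ρ iso (edge i))
  , (λ i j i≢j → (λ e → i≢j (x-injective e))
                , x≢ρx i j
                , (λ e → i≢j (x-injective (ρ-injective ρ e))))
  , (λ i j i≢j → Sum.map id (inj₂ ∘ inj₂) (adj-or-adj-ρ (i≢j ∘ x-injective)))
  where
  open Antimorphism G ρ iso

  halfMatching : ∀ {a p} → IsCycleOf ρ a (4 * p) → 1 ≤ p → OrbitMatching a (2 * p)
  halfMatching {a} {p} cycle p≥1 =
    orbitMatching (subst (IsCycleOf ρ a) (*-assoc 2 2 p) cycle)
                  (≤-trans (s≤s z≤n) (*-monoʳ-≤ 2 p≥1))

  orbits-apart : DisjointOrbits ρ a b
  orbits-apart = cycles-disjointOrbits ρ {{>-nonZero (*-monoʳ-< 4 k≥1)}}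
                   {{>-nonZero (*-monoʳ-< 4 l≥1)}} cycleA cycleB apart

  A : OrbitMatching a (2 * k)
  A = halfMatching cycleA k≥1

  B : OrbitMatching b (2 * l)
  B = halfMatching cycleB l≥1

  M : Matching (2 * n)
  M = subst Matching (trans (sym (*-distribˡ-+ 2 k l)) (cong (2 *_) k+l≡n))
        (matching-++ (proj₁ A) (proj₁ B)
          (λ t t′ → disjointOrbits-onOrbit ρ orbits-apart (proj₂ A t) (proj₂ B t′)))

  open Matching M
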